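{- Let $n\ge 2$ and $T>0$. For every $B\in M_{n-1,n}(\mathbb{Z})$ whose entries have absolute value at most $T$ and which can be extended by adding a last row to a matrix in $\mathrm{SL}_n(\mathbb{Z})$, one may choose this last row with entries of absolute value at most $nT/2+1$. -}

module Defs where

open import Data.Nat as ℕ using (ℕ; zero; suc)
open import Data.Fin using (Fin; zero; suc; punchIn; toℕ)
open import Data.Integer as ℤ using (ℤ; +_; -_; _*_; _+_; _-_)
open import Relation.Binary.PropositionalEquality using (_≡_)

Mat : ℕ → ℕ → Set
Mat m n = Fin m → Fin n → ℤ

∑ : ∀ {n} → (Fin n → ℤ) → ℤ
∑ {zero}  f = + 0
∑ {suc n} f = f zero + ∑ (λ i → f (suc i))

sgn : ℕ → ℤ
sgn zero = + 1
sgn (suc k) = - sgn k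

det : ∀ {n} → Mat n n → ℤ
det {zero}  A = + 1
det {suc n} A = ∑ λ j → sgn (toℕ j) * (A zero j * det (λ r c → A (suc r) (punchIn j c)))

InSL : ∀ {n} → Mat n n → Set
InSL A = det A ≡ + 1


appendRow : ∀ {k m} → Mat k m → (Fin m → ℤ) → Mat (suc k) m
appendRow {zero}  B r zero    c = r c
appendRow {suc k} B r zero    c = B zero c
appendRow {suc k} B r (suc i) c = appendRow {k} (λ i' → B (suc i')) r i c

-- Let A be a completion of B with det A = 1. Some cofactor c of its last row is nonzero, and the
-- column of the adjugate through c gives integers y with c·s + yB a unit vector, s the last row of A.
-- Adding qB to s, with qᵢ the integer nearest to yᵢ/c, keeps the determinant, and
-- c·(s + qB) = (c·s + yB) − ρB with ∣ρᵢ∣ ≤ ∣c∣/2; dividing by ∣c∣ bounds each entry of the new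
-- last row by 1 + ½ Σᵢ ∣Bᵢₗ∣ ≤ 1 + (n − 1)T/2.
module Submission where

open import Defs
open import Function using (_∘_)
open import Data.Nat as ℕ using (ℕ; zero; suc; _≥_)
import Data.Nat.Properties as ℕ
open import Algebra.Properties.Semiring.Sum ℕ.+-*-semiring using (sum; sum-cong-≗; *-distribˡ-sum; *-distribʳ-sum)
open import Data.Fin using (Fin; zero; suc; punchIn; punchOut; toℕ; fromℕ)
open import Data.Product using (∃; ∃₂; _×_; _,_; proj₁; proj₂)
open import Relation.Binary.PropositionalEquality

sum-mono-≤ : ∀ {n} {f g : Fin n → ℕ} → (∀ i → f i ℕ.≤ g i) → sum f ℕ.≤ sum g
sum-mono-≤ {zero}  f≤g = ℕ.z≤n
sum-mono-≤ {suc n} f≤g = ℕ.+-mono-≤ (f≤g zero) (sum-mono-≤ (f≤g ∘ suc))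

halving-bound : ∀ {n} N R (p b : Fin n → ℕ) .{{_ : ℕ.NonZero N}} → (∀ i → 2 ℕ.* p i ℕ.≤ N) →
  R ℕ.* N ℕ.≤ 1 ℕ.+ sum (λ i → b i ℕ.* p i) → 2 ℕ.* R ℕ.≤ 2 ℕ.+ sum b
halving-bound N R p b 2p≤N RN≤ = ℕ.*-cancelʳ-≤ (2 ℕ.* R) (2 ℕ.+ sum b) N (begin
  2 ℕ.* R ℕ.* N                              ≡⟨ ℕ.*-assoc 2 R N ⟩
  2 ℕ.* (R ℕ.* N)                            ≤⟨ ℕ.*-monoʳ-≤ 2 RN≤ ⟩
  2 ℕ.* (1 ℕ.+ sum (λ i → b i ℕ.* p i))      ≡⟨ ℕ.*-distribˡ-+ 2 1 _ ⟩
  2 ℕ.+ 2 ℕ.* sum (λ i → b i ℕ.* p i)        ≡⟨ cong (2 ℕ.+_) (*-distribˡ-sum 2 (λ i → b i ℕ.* p i)) ⟩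
  2 ℕ.+ sum (λ i → 2 ℕ.* (b i ℕ.* p i))      ≤⟨ ℕ.+-monoʳ-≤ 2 (sum-mono-≤ 2bp≤bN) ⟩
  2 ℕ.+ sum (λ i → b i ℕ.* N)                ≡⟨ cong (2 ℕ.+_) (*-distribʳ-sum N b) ⟨
  2 ℕ.+ sum b ℕ.* N                          ≤⟨ ℕ.+-monoˡ-≤ (sum b ℕ.* N) (ℕ.m≤m*n 2 N) ⟩
  2 ℕ.* N ℕ.+ sum b ℕ.* N                    ≡⟨ ℕ.*-distribʳ-+ N 2 (sum b) ⟨
  (2 ℕ.+ sum b) ℕ.* N                        ∎)
  where
  open ℕ.≤-Reasoning
  2bp≤bN : ∀ i → 2 ℕ.* (b i ℕ.* p i) ℕ.≤ b i ℕ.* N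
  2bp≤bN i = begin
    2 ℕ.* (b i ℕ.* p i)   ≡⟨ ℕ.*-assoc 2 (b i) (p i) ⟨
    2 ℕ.* b i ℕ.* p i     ≡⟨ cong (ℕ._* p i) (ℕ.*-comm 2 (b i)) ⟩
    b i ℕ.* 2 ℕ.* p i     ≡⟨ ℕ.*-assoc (b i) 2 (p i) ⟩
    b i ℕ.* (2 ℕ.* p i)   ≤⟨ ℕ.*-monoʳ-≤ (b i) (2p≤N i) ⟩
    b i ℕ.* N             ∎

module IntegerMatrices where

  open import Relation.Nullary using (Dec; yes; no)
  open import Data.Fin.Properties using (punchInᵢ≢i; punchIn-punchOut; punchOut-injective)
  open import Data.Fin using (_≟_)
  open import Data.Vec.Functional using (updateAt)
  open import Data.Vec.Functional.Properties using (updateAt-updates; updateAt-minimal)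
  open import Data.Integer using (ℤ; +_; -_; -[1+_]; -1ℤ; _+_; _*_; _-_; ∣_∣; NonZero; ≢-nonZero)
  open import Data.Integer.DivMod using (_/_; _%_; a≡a%n+[a/n]*n; n%d<d)
  open import Data.Integer.Properties hiding (_≟_)
  import Data.Integer.Properties as ℤ
  open import Data.Integer.Tactic.RingSolver using (solve-∀)
  open import Algebra.Bundles using (AbelianGroup)
  open import Algebra.Properties.Group (AbelianGroup.group +-0-abelianGroup) using (∙-cancelˡ)
  open import Algebra.Properties.CommutativeSemigroup +-commutativeSemigroup
    using () renaming (interchange to +-interchange; x∙yz≈y∙xz to +-leftComm)
  open import Algebra.Properties.CommutativeSemigroup *-commutativeSemigroup
    using () renaming (x∙yz≈y∙xz to *-leftComm)
  open import Data.Empty using (⊥-elim)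

  -- The ∑ of Defs is not definitionally the library's sum, so its few laws are derived directly.
  ∑-cong : ∀ {n} {f g : Fin n → ℤ} → (∀ i → f i ≡ g i) → ∑ f ≡ ∑ g
  ∑-cong {zero}  f≗g = refl
  ∑-cong {suc n} f≗g = cong₂ _+_ (f≗g zero) (∑-cong (f≗g ∘ suc))

  ∑-zero : ∀ {n} {f : Fin n → ℤ} → (∀ i → f i ≡ + 0) → ∑ f ≡ + 0
  ∑-zero {zero}  f≗0 = refl
  ∑-zero {suc n} f≗0 = cong₂ _+_ (f≗0 zero) (∑-zero (f≗0 ∘ suc))

  ∑-distrib-+ : ∀ {n} (f g : Fin n → ℤ) → ∑ (λ i → f i + g i) ≡ ∑ f + ∑ g
  ∑-distrib-+ {zero}  f g = refl
  ∑-distrib-+ {suc n} f g = trans (cong (_+_ (f zero + g zero)) (∑-distrib-+ (f ∘ suc) (g ∘ suc)))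
                                  (+-interchange (f zero) (g zero) (∑ (f ∘ suc)) (∑ (g ∘ suc)))

  *-distribˡ-∑ : ∀ {n} x (f : Fin n → ℤ) → x * ∑ f ≡ ∑ (λ i → x * f i)
  *-distribˡ-∑ {zero}  x f = *-zeroʳ x
  *-distribˡ-∑ {suc n} x f = trans (*-distribˡ-+ x (f zero) (∑ (f ∘ suc)))
                                   (cong (_+_ (x * f zero)) (*-distribˡ-∑ x (f ∘ suc)))

  *-distribʳ-∑ : ∀ {n} x (f : Fin n → ℤ) → ∑ f * x ≡ ∑ (λ i → f i * x)
  *-distribʳ-∑ x f = trans (*-comm (∑ f) x) (trans (*-distribˡ-∑ x f) (∑-cong λ i → *-comm x (f i)))

  *-distribˡ-∑₂ : ∀ {n} x y (f : Fin n → ℤ) → x * (y * ∑ f) ≡ ∑ (λ i → x * (y * f i))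
  *-distribˡ-∑₂ x y f = trans (cong (x *_) (*-distribˡ-∑ y f)) (*-distribˡ-∑ x (λ i → y * f i))

  ∑-comm : ∀ {m n} (f : Fin m → Fin n → ℤ) → ∑ (λ i → ∑ (f i)) ≡ ∑ (λ j → ∑ (λ i → f i j))
  ∑-comm {zero} {n} f = sym (∑-zero {n} λ _ → refl)
  ∑-comm {suc m} f = trans (cong (_+_ (∑ (f zero))) (∑-comm (f ∘ suc))) (sym (∑-distrib-+ (f zero) _))

  ∑-punchIn : ∀ {n} (f : Fin (suc n) → ℤ) j → ∑ f ≡ f j + ∑ (f ∘ punchIn j)
  ∑-punchIn         f zero    = refl
  ∑-punchIn {suc n} f (suc j) = trans (cong (_+_ (f zero)) (∑-punchIn (f ∘ suc) j))
                                      (+-leftComm (f zero) (f (suc j)) _)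

  ∑-offDiagonal-transpose : ∀ {n} (g : Fin (suc n) → Fin (suc n) → ℤ) →
    ∑ (λ k → ∑ (λ c → g (punchIn k c) k)) ≡ ∑ (λ k → ∑ (λ c → g k (punchIn k c)))
  ∑-offDiagonal-transpose g = ∙-cancelˡ (∑ diagonal) _ _ (begin
    ∑ diagonal + ∑ below                          ≡⟨ ∑-distrib-+ diagonal below ⟨
    ∑ (λ k → g k k + below k)                     ≡⟨ ∑-cong (λ k → ∑-punchIn (λ k' → g k' k) k) ⟨
    ∑ (λ k → ∑ (λ k' → g k' k))                   ≡⟨ ∑-comm g ⟨
    ∑ (λ k → ∑ (g k))                             ≡⟨ ∑-cong (λ k → ∑-punchIn (g k) k) ⟩
    ∑ (λ k → g k k + above k)                     ≡⟨ ∑-distrib-+ diagonal above ⟩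
    ∑ diagonal + ∑ above                          ∎)
    where
    open ≡-Reasoning
    diagonal below above : Fin _ → ℤ
    diagonal k = g k k
    below k = ∑ (λ c → g (punchIn k c) k)
    above k = ∑ (λ c → g k (punchIn k c))

  ∑≢0⇒∃≢0 : ∀ {n} (f : Fin n → ℤ) → ∑ f ≢ + 0 → ∃ λ i → f i ≢ + 0
  ∑≢0⇒∃≢0 {zero}  f ∑f≢0 = ⊥-elim (∑f≢0 refl)
  ∑≢0⇒∃≢0 {suc n} f ∑f≢0 with f zero ℤ.≟ + 0
  ... | no f0≢0 = zero , f0≢0
  ... | yes f0≡0 with ∑≢0⇒∃≢0 (f ∘ suc) (λ ∑≡0 → ∑f≢0 (cong₂ _+_ f0≡0 ∑≡0))
  ...   | i , fi≢0 = suc i , fi≢0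

  ∣∑∣≤∑∣∣ : ∀ {n} (f : Fin n → ℤ) → ∣ ∑ f ∣ ℕ.≤ sum (λ i → ∣ f i ∣)
  ∣∑∣≤∑∣∣ {zero}  f = ℕ.z≤n
  ∣∑∣≤∑∣∣ {suc n} f = ℕ.≤-trans (∣i+j∣≤∣i∣+∣j∣ (f zero) (∑ (f ∘ suc))) (ℕ.+-monoʳ-≤ ∣ f zero ∣ (∣∑∣≤∑∣∣ (f ∘ suc)))

  sgn-+ : ∀ a b → sgn (a ℕ.+ b) ≡ sgn a * sgn b
  sgn-+ zero    b = sym (*-identityˡ (sgn b))
  sgn-+ (suc a) b = trans (cong -_ (sgn-+ a b)) (neg-distribˡ-* (sgn a) (sgn b))

  sgn-suc-+-suc : ∀ a b → sgn (suc a ℕ.+ suc b) ≡ sgn (a ℕ.+ b)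
  sgn-suc-+-suc a b = trans (cong (-_ ∘ sgn) (ℕ.+-suc a b)) (neg-involutive (sgn (a ℕ.+ b)))

  minor : ∀ {n} → Fin (suc n) → Fin (suc n) → Mat (suc n) (suc n) → Mat n n
  minor i j A r c = A (punchIn i r) (punchIn j c)

  cofactor : ∀ {n} → Mat (suc n) (suc n) → Fin (suc n) → Fin (suc n) → ℤ
  cofactor A i j = sgn (toℕ i ℕ.+ toℕ j) * det (minor i j A)

  transpose : ∀ {m n} → Mat m n → Mat n m
  transpose A i j = A j i

  det-cong : ∀ {n} {A A′ : Mat n n} → (∀ r c → A r c ≡ A′ r c) → det A ≡ det A′
  det-cong {zero}  A≗A′ = refl
  det-cong {suc n} A≗A′ = ∑-cong λ j →
    cong₂ (λ a d → sgn (toℕ j) * (a * d)) (A≗A′ zero j) (det-cong λ r c → A≗A′ (suc r) (punchIn j c))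

  -- The position of k′ in the list of indices with k deleted.
  indexWithout : ∀ {n} → Fin (suc n) → Fin (suc n) → ℕ
  indexWithout zero            k′       = ℕ.pred (toℕ k′)
  indexWithout (suc k)         zero     = 0
  indexWithout {suc n} (suc k) (suc k′) = suc (indexWithout k k′)

  indexWithout-punchIn : ∀ {n} (k : Fin (suc n)) c → indexWithout k (punchIn k c) ≡ toℕ c
  indexWithout-punchIn zero            c       = refl
  indexWithout-punchIn (suc k)         zero    = refl
  indexWithout-punchIn {suc n} (suc k) (suc c) = cong suc (indexWithout-punchIn k c)

  sgn-indexWithout-swap : ∀ {n} {k k′ : Fin (suc n)} → k ≢ k′ →
    sgn (toℕ k ℕ.+ indexWithout k k′) ≡ - sgn (toℕ k′ ℕ.+ indexWithout k′ k)
  sgn-indexWithout-swap {k = zero}  {zero}   k≢k′ = ⊥-elim (k≢k′ refl)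
  sgn-indexWithout-swap {k = zero}  {suc k′} _    =
    sym (trans (neg-involutive _) (cong sgn (ℕ.+-identityʳ (toℕ k′))))
  sgn-indexWithout-swap {k = suc k} {zero}   _    = cong (-_ ∘ sgn) (ℕ.+-identityʳ (toℕ k))
  sgn-indexWithout-swap {suc n} {suc k} {suc k′} k≢k′ =
    trans (sgn-suc-+-suc (toℕ k) _)
      (trans (sgn-indexWithout-swap (k≢k′ ∘ cong suc)) (cong -_ (sym (sgn-suc-+-suc (toℕ k′) _))))

  -- The increasing enumeration of the indices different from k and k′.
  punchIn₂ : ∀ {m} → Fin (suc (suc m)) → Fin (suc (suc m)) → Fin m → Fin (suc (suc m))
  punchIn₂               zero    zero     d       = suc (punchIn zero d)
  punchIn₂               zero    (suc k′) d       = suc (punchIn k′ d)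
  punchIn₂               (suc k) zero     d       = suc (punchIn k d)
  punchIn₂ {suc m}       (suc k) (suc k′) zero    = zero
  punchIn₂ {suc m}       (suc k) (suc k′) (suc d) = suc (punchIn₂ k k′ d)

  punchIn-punchIn : ∀ {m} (k : Fin (suc (suc m))) c d → punchIn k (punchIn c d) ≡ punchIn₂ k (punchIn k c) d
  punchIn-punchIn         zero    c       d       = refl
  punchIn-punchIn         (suc k) zero    d       = refl
  punchIn-punchIn {suc m} (suc k) (suc c) zero    = refl
  punchIn-punchIn {suc m} (suc k) (suc c) (suc d) = cong suc (punchIn-punchIn k c d)

  punchIn₂-comm : ∀ {m} {k k′ : Fin (suc (suc m))} → k ≢ k′ → ∀ d → punchIn₂ k k′ d ≡ punchIn₂ k′ k d
  punchIn₂-comm {k = zero}  {zero}   k≢k′ d = ⊥-elim (k≢k′ refl)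
  punchIn₂-comm {k = zero}  {suc k′} _    d = refl
  punchIn₂-comm {k = suc k} {zero}   _    d = refl
  punchIn₂-comm {suc m} {suc k} {suc k′} _    zero    = refl
  punchIn₂-comm {suc m} {suc k} {suc k′} k≢k′ (suc d) = cong suc (punchIn₂-comm (k≢k′ ∘ cong suc) d)

  -- Induction on the row: expand along row 0 and then each minor along row i; the resulting
  -- sum over ordered pairs of distinct columns is reordered and regrouped as the expansion along row i + 1.
  det-expand-row : ∀ {n} (A : Mat (suc n) (suc n)) i → det A ≡ ∑ (λ j → A i j * cofactor A i j)
  det-expand-row A zero = ∑-cong λ j → *-leftComm (sgn (toℕ j)) (A zero j) (det (minor zero j A))
  det-expand-row {suc m} A (suc i) = begin
    det A                                        ≡⟨ ∑-cong expand-minor ⟩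
    ∑ (λ k → ∑ (λ c → g k (punchIn k c)))        ≡⟨ ∑-offDiagonal-transpose g ⟨
    ∑ (λ k → ∑ (λ c → g (punchIn k c) k))        ≡⟨ ∑-cong (λ k → ∑-cong λ c → g-transpose (punchInᵢ≢i k c ∘ sym)) ⟩
    ∑ (λ k → ∑ (λ c → h k (punchIn k c)))        ≡⟨ ∑-cong expand-cofactor ⟨
    ∑ (λ k → A (suc i) k * cofactor A (suc i) k) ∎
    where
    open ≡-Reasoning
    D : Fin (suc (suc m)) → Fin (suc (suc m)) → ℤ
    D k k′ = det (λ r d → A (suc (punchIn i r)) (punchIn₂ k k′ d))

    g h : Fin (suc (suc m)) → Fin (suc (suc m)) → ℤ
    g k k′ = sgn (toℕ k) * (A zero k * (A (suc i) k′ * (sgn (toℕ i ℕ.+ indexWithout k k′) * D k k′)))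
    h k k′ = A (suc i) k * (sgn (suc (toℕ i ℕ.+ toℕ k)) * (sgn (indexWithout k k′) * (A zero k′ * D k k′)))

    minor-minor : ∀ k c → det (minor i c (minor zero k A)) ≡ D k (punchIn k c)
    minor-minor k c = det-cong λ r d → cong (A (suc (punchIn i r))) (punchIn-punchIn k c d)

    expand-minor : ∀ k → sgn (toℕ k) * (A zero k * det (minor zero k A)) ≡ ∑ (λ c → g k (punchIn k c))
    expand-minor k =
      trans (cong (λ d → sgn (toℕ k) * (A zero k * d)) (det-expand-row (minor zero k A) i))
      (trans (*-distribˡ-∑₂ (sgn (toℕ k)) (A zero k) (λ c → A (suc i) (punchIn k c) * cofactor (minor zero k A) i c))
      (∑-cong λ c → cong₂ (λ p d → sgn (toℕ k) * (A zero k * (A (suc i) (punchIn k c) * (sgn (toℕ i ℕ.+ p) * d))))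
                          (sym (indexWithout-punchIn k c)) (minor-minor k c)))

    expand-cofactor : ∀ k → A (suc i) k * cofactor A (suc i) k ≡ ∑ (λ c → h k (punchIn k c))
    expand-cofactor k =
      trans (*-distribˡ-∑₂ (A (suc i) k) (sgn (suc (toℕ i ℕ.+ toℕ k))) (λ c → sgn (toℕ c) * (A zero (punchIn k c) * det (minor i c (minor zero k A)))))
      (∑-cong λ c → cong₂ (λ p d → A (suc i) k * (sgn (suc (toℕ i ℕ.+ toℕ k)) * (sgn p * (A zero (punchIn k c) * d))))
                          (sym (indexWithout-punchIn k c)) (minor-minor k c))

    signs : ∀ {k k′} → k ≢ k′ →
      sgn (toℕ k′) * sgn (toℕ i ℕ.+ indexWithout k′ k) ≡ sgn (suc (toℕ i ℕ.+ toℕ k)) * sgn (indexWithout k k′)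
    signs {k} {k′} k≢k′ = begin
      sgn (toℕ k′) * sgn (toℕ i ℕ.+ p′)          ≡⟨ cong (sgn (toℕ k′) *_) (sgn-+ (toℕ i) p′) ⟩
      sgn (toℕ k′) * (sgn (toℕ i) * sgn p′)      ≡⟨ *-leftComm (sgn (toℕ k′)) (sgn (toℕ i)) (sgn p′) ⟩
      sgn (toℕ i) * (sgn (toℕ k′) * sgn p′)      ≡⟨ cong (sgn (toℕ i) *_) (sgn-+ (toℕ k′) p′) ⟨
      sgn (toℕ i) * sgn (toℕ k′ ℕ.+ p′)          ≡⟨ cong (sgn (toℕ i) *_) (sgn-indexWithout-swap (k≢k′ ∘ sym)) ⟩
      sgn (toℕ i) * - sgn (toℕ k ℕ.+ p)          ≡⟨ neg-distribʳ-* (sgn (toℕ i)) _ ⟨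
      - (sgn (toℕ i) * sgn (toℕ k ℕ.+ p))        ≡⟨ cong -_ (sgn-+ (toℕ i) (toℕ k ℕ.+ p)) ⟨
      sgn (suc (toℕ i ℕ.+ (toℕ k ℕ.+ p)))        ≡⟨ cong (sgn ∘ suc) (ℕ.+-assoc (toℕ i) (toℕ k) p) ⟨
      sgn (suc (toℕ i ℕ.+ toℕ k) ℕ.+ p)          ≡⟨ sgn-+ (suc (toℕ i ℕ.+ toℕ k)) p ⟩
      sgn (suc (toℕ i ℕ.+ toℕ k)) * sgn p        ∎
      where
      p = indexWithout k k′
      p′ = indexWithout k′ k

    g-transpose : ∀ {k k′} → k ≢ k′ → g k′ k ≡ h k k′
    g-transpose {k} {k′} k≢k′ = begin
      g k′ k                              ≡⟨ cong (λ d → s′ * (a * (b * (t′ * d)))) D-comm ⟩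
      s′ * (a * (b * (t′ * D k k′)))      ≡⟨ gather s′ t′ a b (D k k′) ⟩
      (s′ * t′) * (a * (b * D k k′))      ≡⟨ cong (_* (a * (b * D k k′))) (signs k≢k′) ⟩
      (s * t) * (a * (b * D k k′))        ≡⟨ scatter s t a b (D k k′) ⟩
      h k k′                              ∎
      where
      s′ = sgn (toℕ k′)
      t′ = sgn (toℕ i ℕ.+ indexWithout k′ k)
      s = sgn (suc (toℕ i ℕ.+ toℕ k))
      t = sgn (indexWithout k k′)
      a = A zero k′
      b = A (suc i) k
      D-comm : D k′ k ≡ D k k′
      D-comm = det-cong λ r d → cong (A (suc (punchIn i r))) (punchIn₂-comm (k≢k′ ∘ sym) d)
      gather : ∀ s′ t′ a b d → s′ * (a * (b * (t′ * d))) ≡ (s′ * t′) * (a * (b * d))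
      gather = solve-∀
      scatter : ∀ s t a b d → (s * t) * (a * (b * d)) ≡ b * (s * (t * (a * d)))
      scatter = solve-∀

  det-expand-column₀ : ∀ {n} (A : Mat (suc n) (suc n)) →
    det A ≡ ∑ (λ i → sgn (toℕ i) * (A i zero * det (minor i zero A)))
  det-expand-column₀ {zero}  A = refl
  det-expand-column₀ {suc m} A = cong (_+_ (+ 1 * (A zero zero * det (minor zero zero A)))) (begin
    ∑ (λ k → sgn (suc (toℕ k)) * (A zero (suc k) * det (minor zero (suc k) A)))
      ≡⟨ ∑-cong (λ k → trans (cong (λ d → sgn (suc (toℕ k)) * (A zero (suc k) * d)) (det-expand-column₀ (minor zero (suc k) A)))
                             (*-distribˡ-∑₂ (sgn (suc (toℕ k))) (A zero (suc k)) (λ i → sgn (toℕ i) * (A (suc i) zero * D i k)))) ⟩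
    ∑ (λ k → ∑ (λ i → sgn (suc (toℕ k)) * (A zero (suc k) * (sgn (toℕ i) * (A (suc i) zero * D i k)))))
      ≡⟨ ∑-comm (λ k i → sgn (suc (toℕ k)) * (A zero (suc k) * (sgn (toℕ i) * (A (suc i) zero * D i k)))) ⟩
    ∑ (λ i → ∑ (λ k → sgn (suc (toℕ k)) * (A zero (suc k) * (sgn (toℕ i) * (A (suc i) zero * D i k)))))
      ≡⟨ ∑-cong (λ i → trans (∑-cong λ k → swap-factors (sgn (toℕ k)) (sgn (toℕ i)) (A zero (suc k)) (A (suc i) zero) (D i k))
                             (sym (*-distribˡ-∑₂ (sgn (suc (toℕ i))) (A (suc i) zero) (λ k → sgn (toℕ k) * (A zero (suc k) * D i k))))) ⟩
    ∑ (λ i → sgn (suc (toℕ i)) * (A (suc i) zero * det (minor (suc i) zero A))) ∎)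
    where
    open ≡-Reasoning
    D : Fin (suc m) → Fin (suc m) → ℤ
    D i k = det (λ r c → A (suc (punchIn i r)) (suc (punchIn k c)))
    swap-factors : ∀ s t a b d → (- s) * (a * (t * (b * d))) ≡ (- t) * (b * (s * (a * d)))
    swap-factors = solve-∀

  det-transpose : ∀ {n} (A : Mat n n) → det (transpose A) ≡ det A
  det-transpose {zero}  A = refl
  det-transpose {suc n} A =
    trans (∑-cong λ j → cong (λ d → sgn (toℕ j) * (A j zero * d)) (det-transpose (minor j zero A)))
          (sym (det-expand-column₀ A))

  cofactor-transpose : ∀ {n} (A : Mat (suc n) (suc n)) i j → cofactor (transpose A) i j ≡ cofactor A j i
  cofactor-transpose A i j = cong₂ _*_ (cong sgn (ℕ.+-comm (toℕ i) (toℕ j))) (det-transpose (minor j i A))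

  det₂-equalRows : (A : Mat 2 2) → (∀ c → A (suc zero) c ≡ A zero c) → det A ≡ + 0
  det₂-equalRows A rows =
    trans (det-cong {A = A} {A′ = λ _ → A zero} λ { zero c → refl ; (suc zero) c → rows c })
          (vanishes (A zero zero) (A zero (suc zero)))
    where
    -- det of the matrix with both rows (a b), as it unfolds
    vanishes : ∀ a b → + 1 * (a * (+ 1 * (b * + 1) + + 0)) + (- + 1 * (b * (+ 1 * (a * + 1) + + 0)) + + 0) ≡ + 0
    vanishes = solve-∀

  ∃-avoiding : ∀ {m} (i i′ : Fin (suc (suc (suc m)))) → ∃ λ j → j ≢ i × j ≢ i′
  ∃-avoiding zero          zero          = suc zero , (λ ()) , (λ ())
  ∃-avoiding zero          (suc zero)    = suc (suc zero) , (λ ()) , (λ ())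
  ∃-avoiding zero          (suc (suc _)) = suc zero , (λ ()) , (λ ())
  ∃-avoiding (suc zero)    zero          = suc (suc zero) , (λ ()) , (λ ())
  ∃-avoiding (suc (suc _)) zero          = suc zero , (λ ()) , (λ ())
  ∃-avoiding (suc _)       (suc _)       = zero , (λ ()) , (λ ())

  -- Expanding along a third row reduces to minors that still have two equal rows.
  det-equalRows : ∀ {n} (A : Mat n n) {i i′} → i ≢ i′ → (∀ c → A i c ≡ A i′ c) → det A ≡ + 0
  det-equalRows {suc zero}       A {zero}     {zero}     i≢i′ _    = ⊥-elim (i≢i′ refl)
  det-equalRows {suc (suc zero)} A {zero}     {zero}     i≢i′ _    = ⊥-elim (i≢i′ refl)
  det-equalRows {suc (suc zero)} A {zero}     {suc zero} _    rows = det₂-equalRows A (sym ∘ rows)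
  det-equalRows {suc (suc zero)} A {suc zero} {zero}     _    rows = det₂-equalRows A rows
  det-equalRows {suc (suc zero)} A {suc zero} {suc zero} i≢i′ _    = ⊥-elim (i≢i′ refl)
  det-equalRows {suc (suc (suc m))} A {i} {i′} i≢i′ rows = trans (det-expand-row A j) (∑-zero λ k →
    trans (cong (λ d → A j k * (sgn (toℕ j ℕ.+ toℕ k) * d))
                (det-equalRows (minor j k A) (i≢i′ ∘ punchOut-injective j≢i j≢i′) (minor-rows k)))
          (trans (cong (A j k *_) (*-zeroʳ (sgn (toℕ j ℕ.+ toℕ k)))) (*-zeroʳ (A j k))))
    where
    open ≡-Reasoning
    j = proj₁ (∃-avoiding i i′)
    j≢i = proj₁ (proj₂ (∃-avoiding i i′))
    j≢i′ = proj₂ (proj₂ (∃-avoiding i i′))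
    minor-rows : ∀ k c → minor j k A (punchOut j≢i) c ≡ minor j k A (punchOut j≢i′) c
    minor-rows k c = begin
      A (punchIn j (punchOut j≢i)) (punchIn k c)  ≡⟨ cong (λ r → A r (punchIn k c)) (punchIn-punchOut j≢i) ⟩
      A i (punchIn k c)                           ≡⟨ rows (punchIn k c) ⟩
      A i′ (punchIn k c)                          ≡⟨ cong (λ r → A r (punchIn k c)) (punchIn-punchOut j≢i′) ⟨
      A (punchIn j (punchOut j≢i′)) (punchIn k c) ∎

  det-linear-in-row : ∀ {n} (A A′ : Mat (suc n) (suc n)) i → (∀ r c → r ≢ i → A′ r c ≡ A r c) →
    det A′ ≡ ∑ (λ j → A′ i j * cofactor A i j)
  det-linear-in-row A A′ i agree = trans (det-expand-row A′ i) (∑-cong λ j →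
    cong (λ d → A′ i j * (sgn (toℕ i ℕ.+ toℕ j) * d))
         (det-cong λ r c → agree (punchIn i r) (punchIn j c) (punchInᵢ≢i i r)))

  det-expand-column : ∀ {n} (A : Mat (suc n) (suc n)) j → det A ≡ ∑ (λ k → A k j * cofactor A k j)
  det-expand-column A j = begin
    det A                                             ≡⟨ det-transpose A ⟨
    det (transpose A)                                 ≡⟨ det-expand-row (transpose A) j ⟩
    ∑ (λ k → A k j * cofactor (transpose A) j k)      ≡⟨ ∑-cong (λ k → cong (A k j *_) (cofactor-transpose A j k)) ⟩
    ∑ (λ k → A k j * cofactor A k j)                  ∎
    where open ≡-Reasoning

  -- Column l against the cofactors of column j is the expansion of the transpose with row j replaced by row l.
  ∑-column-cofactor-≢ : ∀ {n} (A : Mat (suc n) (suc n)) {j l} → j ≢ l → ∑ (λ k → A k l * cofactor A k j) ≡ + 0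
  ∑-column-cofactor-≢ A {j} {l} j≢l = begin
    ∑ (λ k → A k l * cofactor A k j)                   ≡⟨ ∑-cong (λ k → cong₂ _*_ (row-j k) (cofactor-transpose A j k)) ⟨
    ∑ (λ k → A′ j k * cofactor (transpose A) j k)      ≡⟨ det-linear-in-row (transpose A) A′ j off-row-j ⟨
    det A′                                             ≡⟨ det-equalRows A′ j≢l (λ c → trans (row-j c) (sym (off-row-j l c (j≢l ∘ sym)))) ⟩
    + 0                                                ∎
    where
    open ≡-Reasoning
    A′ : Mat _ _
    A′ = updateAt (transpose A) j (λ _ → transpose A l)
    row-j : ∀ c → A′ j c ≡ A c l
    row-j = cong-app (updateAt-updates j (transpose A))
    off-row-j : ∀ r c → r ≢ j → A′ r c ≡ transpose A r c
    off-row-j r c r≢j = cong-app (updateAt-minimal r j (transpose A) r≢j) c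

  ∣∑-column-cofactor∣≤1 : ∀ {n} (A : Mat (suc n) (suc n)) → det A ≡ + 1 →
    ∀ j l → ∣ ∑ (λ k → A k l * cofactor A k j) ∣ ℕ.≤ 1
  ∣∑-column-cofactor∣≤1 A det≡1 j l with j ≟ l
  ... | yes refl = ℕ.≤-reflexive (cong ∣_∣ (trans (sym (det-expand-column A j)) det≡1))
  ... | no j≢l   = subst (λ t → ∣ t ∣ ℕ.≤ 1) (sym (∑-column-cofactor-≢ A j≢l)) ℕ.z≤n

  appendRow-last : ∀ {k m} (B : Mat k m) r c → appendRow B r (fromℕ k) c ≡ r c
  appendRow-last {zero}  B r c = refl
  appendRow-last {suc k} B r c = appendRow-last (B ∘ suc) r c

  appendRow-punchIn-last : ∀ {k m} (B : Mat k m) r i c → appendRow B r (punchIn (fromℕ k) i) c ≡ B i c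
  appendRow-punchIn-last {suc k} B r zero    c = refl
  appendRow-punchIn-last {suc k} B r (suc i) c = appendRow-punchIn-last (B ∘ suc) r i c

  appendRow-≢-last : ∀ {k m} (B : Mat k m) r r′ i c → i ≢ fromℕ k → appendRow B r i c ≡ appendRow B r′ i c
  appendRow-≢-last {k} B r r′ i c i≢last = begin
    appendRow B r i c                         ≡⟨ cong (λ i → appendRow B r i c) (punchIn-punchOut last≢i) ⟨
    appendRow B r (punchIn (fromℕ k) i′) c    ≡⟨ appendRow-punchIn-last B r i′ c ⟩
    B i′ c                                    ≡⟨ appendRow-punchIn-last B r′ i′ c ⟨
    appendRow B r′ (punchIn (fromℕ k) i′) c   ≡⟨ cong (λ i → appendRow B r′ i c) (punchIn-punchOut last≢i) ⟩
    appendRow B r′ i c                        ∎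
    where
    open ≡-Reasoning
    last≢i = i≢last ∘ sym
    i′ = punchOut last≢i

  det-appendRow : ∀ {k} (B : Mat k (suc k)) s r →
    det (appendRow B r) ≡ ∑ (λ l → r l * cofactor (appendRow B s) (fromℕ k) l)
  det-appendRow {k} B s r =
    trans (det-linear-in-row (appendRow B s) (appendRow B r) (fromℕ k) (λ i c → appendRow-≢-last B r s i c))
          (∑-cong λ l → cong (_* cofactor (appendRow B s) (fromℕ k) l) (appendRow-last B r l))

  ∑-row-cofactor-last : ∀ {k} (B : Mat k (suc k)) s i → ∑ (λ l → B i l * cofactor (appendRow B s) (fromℕ k) l) ≡ + 0
  ∑-row-cofactor-last {k} B s i = trans (sym (det-appendRow B s (B i)))
    (det-equalRows (appendRow B (B i)) (punchInᵢ≢i (fromℕ k) i)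
                   (λ c → trans (appendRow-punchIn-last B (B i) i c) (sym (appendRow-last B (B i) c))))

  det-appendRow-+-combination : ∀ {k} (B : Mat k (suc k)) s (q : Fin k → ℤ) →
    det (appendRow B (λ l → s l + ∑ (λ i → q i * B i l))) ≡ det (appendRow B s)
  det-appendRow-+-combination {k} B s q = begin
    det (appendRow B (λ l → s l + ∑ (λ i → q i * B i l)))          ≡⟨ det-appendRow B s _ ⟩
    ∑ (λ l → (s l + ∑ (λ i → q i * B i l)) * C l)                  ≡⟨ ∑-cong distribute ⟩
    ∑ (λ l → s l * C l + ∑ (λ i → q i * (B i l * C l)))            ≡⟨ ∑-distrib-+ (λ l → s l * C l) (λ l → ∑ (λ i → q i * (B i l * C l))) ⟩
    ∑ (λ l → s l * C l) + ∑ (λ l → ∑ (λ i → q i * (B i l * C l)))  ≡⟨ cong₂ _+_ (sym (det-appendRow B s s)) (∑-comm (λ l i → q i * (B i l * C l))) ⟩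
    det (appendRow B s) + ∑ (λ i → ∑ (λ l → q i * (B i l * C l)))  ≡⟨ cong (_+_ (det (appendRow B s))) (∑-zero vanishes) ⟩
    det (appendRow B s) + + 0                                      ≡⟨ +-identityʳ _ ⟩
    det (appendRow B s)                                            ∎
    where
    open ≡-Reasoning
    C : Fin (suc k) → ℤ
    C = cofactor (appendRow B s) (fromℕ k)
    distribute : ∀ l → (s l + ∑ (λ i → q i * B i l)) * C l ≡ s l * C l + ∑ (λ i → q i * (B i l * C l))
    distribute l = trans (*-distribʳ-+ (C l) (s l) _) (cong (_+_ (s l * C l))
      (trans (*-distribʳ-∑ (C l) (λ i → q i * B i l)) (∑-cong λ i → *-assoc (q i) (B i l) (C l))))
    vanishes : ∀ i → ∑ (λ l → q i * (B i l * C l)) ≡ + 0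
    vanishes i = trans (sym (*-distribˡ-∑ (q i) (λ l → B i l * C l)))
                       (trans (cong (q i *_) (∑-row-cofactor-last B s i)) (*-zeroʳ (q i)))

  ∃-sign-* : ∀ c → ∃ λ σ → σ * c ≡ + ∣ c ∣
  ∃-sign-* (+ n)      = + 1 , *-identityˡ (+ n)
  ∃-sign-* (-[1+ n ]) = -1ℤ , -1*i≡-i -[1+ n ]

  -- Floor division leaves a remainder in [0, ∣c∣); when it exceeds ∣c∣/2, shift it down by ∣c∣.
  ∃-balanced-division : ∀ y c → c ≢ + 0 → ∃₂ λ q ρ → y ≡ q * c + ρ × 2 ℕ.* ∣ ρ ∣ ℕ.≤ ∣ c ∣
  ∃-balanced-division y c c≢0 = balance (2 ℕ.* M ℕ.≤? N)
    where
    instance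
      c-nonZero : NonZero c
      c-nonZero = ≢-nonZero c≢0
    N M : ℕ
    N = ∣ c ∣
    M = y % c
    Q : ℤ
    Q = y / c
    σ = proj₁ (∃-sign-* c)
    σc≡N = proj₂ (∃-sign-* c)
    balance : Dec (2 ℕ.* M ℕ.≤ N) → ∃₂ λ q ρ → y ≡ q * c + ρ × 2 ℕ.* ∣ ρ ∣ ℕ.≤ N
    balance (yes 2M≤N) = Q , + M , trans (a≡a%n+[a/n]*n y c) (+-comm (+ M) (Q * c)) , 2M≤N
    balance (no 2M≰N)  = Q + σ , + M - + N , shifted , ℕ.≤-trans (ℕ.≤-reflexive 2∣ρ∣≡) 2N∸2M≤N
      where
      shifted : y ≡ (Q + σ) * c + (+ M - + N)
      shifted = trans (a≡a%n+[a/n]*n y c)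
        (trans (shift (+ M) Q σ c) (cong (λ t → (Q + σ) * c + (+ M - t)) σc≡N))
        where
        shift : ∀ m q s c → m + q * c ≡ (q + s) * c + (m - s * c)
        shift = solve-∀
      2∣ρ∣≡ : 2 ℕ.* ∣ + M - + N ∣ ≡ 2 ℕ.* N ℕ.∸ 2 ℕ.* M
      2∣ρ∣≡ = trans (cong (2 ℕ.*_) (trans (cong ∣_∣ (m-n≡m⊖n M N)) (∣⊖∣-< (n%d<d y c))))
                    (ℕ.*-distribˡ-∸ 2 N M)
      2N∸2M≤N : 2 ℕ.* N ℕ.∸ 2 ℕ.* M ℕ.≤ N
      2N∸2M≤N = ℕ.m≤n+o⇒m∸n≤o (2 ℕ.* N) (2 ℕ.* M)
        (ℕ.≤-trans (ℕ.≤-reflexive (cong (N ℕ.+_) (ℕ.+-identityʳ N))) (ℕ.+-monoˡ-≤ N (ℕ.<⇒≤ (ℕ.≰⇒> 2M≰N))))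

  ∃-short-translate : ∀ {n m} (B : Mat n m) (s : Fin m → ℤ) c (y : Fin n → ℤ) → c ≢ + 0 →
    (∀ l → ∣ s l * c + ∑ (λ i → B i l * y i) ∣ ℕ.≤ 1) →
    ∃ λ (q : Fin n → ℤ) → ∀ l → 2 ℕ.* ∣ s l + ∑ (λ i → q i * B i l) ∣ ℕ.≤ 2 ℕ.+ sum (λ i → ∣ B i l ∣)
  ∃-short-translate B s c y c≢0 near = q , λ l →
    halving-bound ∣ c ∣ ∣ r l ∣ (λ i → ∣ ρ i ∣) (λ i → ∣ B i l ∣) 2∣ρ∣≤∣c∣ (scaled-bound l)
    where
    instance
      ∣c∣-nonZero : ℕ.NonZero ∣ c ∣
      ∣c∣-nonZero = ℕ.≢-nonZero (c≢0 ∘ ∣i∣≡0⇒i≡0)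
    division : ∀ i → ∃₂ λ q ρ → y i ≡ q * c + ρ × 2 ℕ.* ∣ ρ ∣ ℕ.≤ ∣ c ∣
    division i = ∃-balanced-division (y i) c c≢0
    q ρ : Fin _ → ℤ
    q i = proj₁ (division i)
    ρ i = proj₁ (proj₂ (division i))
    y≡ : ∀ i → y i ≡ q i * c + ρ i
    y≡ i = proj₁ (proj₂ (proj₂ (division i)))
    2∣ρ∣≤∣c∣ : ∀ i → 2 ℕ.* ∣ ρ i ∣ ℕ.≤ ∣ c ∣
    2∣ρ∣≤∣c∣ i = proj₂ (proj₂ (proj₂ (division i)))
    r : Fin _ → ℤ
    r l = s l + ∑ (λ i → q i * B i l)
    scaled : ∀ l → r l * c ≡ (s l * c + ∑ (λ i → B i l * y i)) - ∑ (λ i → B i l * ρ i)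
    scaled l = begin
      (s l + ∑ (λ i → q i * B i l)) * c                              ≡⟨ *-distribʳ-+ c (s l) (∑ (λ i → q i * B i l)) ⟩
      s l * c + ∑ (λ i → q i * B i l) * c                            ≡⟨ cong (_+_ (s l * c)) (*-distribʳ-∑ c (λ i → q i * B i l)) ⟩
      s l * c + ∑ (λ i → q i * B i l * c)                            ≡⟨ cong (_+_ (s l * c)) (∑-cong λ i → rearrange (q i) (B i l) c) ⟩
      s l * c + ∑ (λ i → B i l * (q i * c))                          ≡⟨ cancel (s l * c) (∑ (λ i → B i l * (q i * c))) (∑ (λ i → B i l * ρ i)) ⟨
      (s l * c + (∑ (λ i → B i l * (q i * c)) + ∑ (λ i → B i l * ρ i))) - ∑ (λ i → B i l * ρ i)
                                                                     ≡⟨ cong (λ t → (s l * c + t) - ∑ (λ i → B i l * ρ i)) split ⟨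
      (s l * c + ∑ (λ i → B i l * y i)) - ∑ (λ i → B i l * ρ i)      ∎
      where
      open ≡-Reasoning
      rearrange : ∀ q b c → q * b * c ≡ b * (q * c)
      rearrange = solve-∀
      cancel : ∀ a x z → (a + (x + z)) - z ≡ a + x
      cancel = solve-∀
      split : ∑ (λ i → B i l * y i) ≡ ∑ (λ i → B i l * (q i * c)) + ∑ (λ i → B i l * ρ i)
      split = trans (∑-cong λ i → trans (cong (B i l *_) (y≡ i)) (*-distribˡ-+ (B i l) (q i * c) (ρ i)))
                    (∑-distrib-+ (λ i → B i l * (q i * c)) (λ i → B i l * ρ i))

    scaled-bound : ∀ l → ∣ r l ∣ ℕ.* ∣ c ∣ ℕ.≤ 1 ℕ.+ sum (λ i → ∣ B i l ∣ ℕ.* ∣ ρ i ∣)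
    scaled-bound l = begin
      ∣ r l ∣ ℕ.* ∣ c ∣                                         ≡⟨ abs-* (r l) c ⟨
      ∣ r l * c ∣                                               ≡⟨ cong ∣_∣ (scaled l) ⟩
      ∣ (s l * c + ∑ (λ i → B i l * y i)) - ∑ (λ i → B i l * ρ i) ∣  ≤⟨ ∣i-j∣≤∣i∣+∣j∣ (s l * c + ∑ (λ i → B i l * y i)) (∑ (λ i → B i l * ρ i)) ⟩
      ∣ s l * c + ∑ (λ i → B i l * y i) ∣ ℕ.+ ∣ ∑ (λ i → B i l * ρ i) ∣  ≤⟨ ℕ.+-mono-≤ (near l) (∣∑∣≤∑∣∣ (λ i → B i l * ρ i)) ⟩
      1 ℕ.+ sum (λ i → ∣ B i l * ρ i ∣)                         ≡⟨ cong (1 ℕ.+_) (sum-cong-≗ λ i → abs-* (B i l) (ρ i)) ⟩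
      1 ℕ.+ sum (λ i → ∣ B i l ∣ ℕ.* ∣ ρ i ∣)                   ∎
      where open ℕ.≤-Reasoning

  short-completion : ∀ {k} (B : Mat k (suc k)) s → InSL (appendRow B s) →
    ∃ λ r → InSL (appendRow B r) × ∀ l → 2 ℕ.* ∣ r l ∣ ℕ.≤ 2 ℕ.+ sum (λ i → ∣ B i l ∣)
  short-completion {k} B s det≡1 =
    let j , Aⱼcⱼ≢0 = ∑≢0⇒∃≢0 (λ l → A last l * cofactor A last l) det≢0
        q , short = ∃-short-translate B s (cofactor A last j) (λ i → cofactor A (punchIn last i) j)
                      (λ cⱼ≡0 → Aⱼcⱼ≢0 (trans (cong (A last j *_) cⱼ≡0) (*-zeroʳ (A last j))))
                      (column-cofactors j)
    in (λ l → s l + ∑ (λ i → q i * B i l)) , trans (det-appendRow-+-combination B s q) det≡1 , short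
    where
    A = appendRow B s
    last = fromℕ k
    det≢0 : ∑ (λ l → A last l * cofactor A last l) ≢ + 0
    det≢0 ∑≡0 with trans (sym det≡1) (trans (det-expand-row A last) ∑≡0)
    ... | ()
    column-cofactors : ∀ j l → ∣ s l * cofactor A last j + ∑ (λ i → B i l * cofactor A (punchIn last i) j) ∣ ℕ.≤ 1
    column-cofactors j l = subst (λ t → ∣ t ∣ ℕ.≤ 1)
      (trans (∑-punchIn (λ k → A k l * cofactor A k j) last)
             (cong₂ _+_ (cong (_* cofactor A last j) (appendRow-last B s l))
                        (∑-cong λ i → cong (_* cofactor A (punchIn last i) j) (appendRow-punchIn-last B s i l))))
      (∣∑-column-cofactor∣≤1 A det≡1 j l)

open IntegerMatrices using (short-completion)
open import Data.Integer as ℤ using (ℤ; +_; -[1+_])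
import Data.Integer.Properties as ℤ
import Data.Nat.Coprimality as Coprime
open import Data.Rational using (ℚ; mkℚ; _/_; 0ℚ; 1ℚ; ½; _≤_; _<_; _+_; _*_; ∣_∣; *≤*; NonNegative; nonNegative)
import Data.Rational.Properties as ℚ

toℚ : ℕ → ℚ
toℚ m = + m / 1

toℚ≡mkℚ : ∀ m → toℚ m ≡ mkℚ (+ m) 0 (Coprime.sym (Coprime.1-coprimeTo m))
toℚ≡mkℚ m = ℚ.normalize-coprime (Coprime.sym (Coprime.1-coprimeTo m))

toℚ-+ : ∀ a b → toℚ (a ℕ.+ b) ≡ toℚ a + toℚ b
toℚ-+ a b rewrite toℚ≡mkℚ a | toℚ≡mkℚ b =
  sym (ℚ./-cong {p₂ = + (a ℕ.+ b)} {q₂ = 1}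
        (trans (cong₂ ℤ._+_ (ℤ.*-identityʳ (+ a)) (ℤ.*-identityʳ (+ b))) (sym (ℤ.pos-+ a b))) refl)

toℚ-* : ∀ a b → toℚ (a ℕ.* b) ≡ toℚ a * toℚ b
toℚ-* a b rewrite toℚ≡mkℚ a | toℚ≡mkℚ b = sym (ℚ./-cong {p₂ = + (a ℕ.* b)} {q₂ = 1} (sym (ℤ.pos-* a b)) refl)

toℚ-mono-≤ : ∀ {a b} → a ℕ.≤ b → toℚ a ≤ toℚ b
toℚ-mono-≤ {a} {b} a≤b rewrite toℚ≡mkℚ a | toℚ≡mkℚ b =
  *≤* (subst₂ ℤ._≤_ (sym (ℤ.*-identityʳ (+ a))) (sym (ℤ.*-identityʳ (+ b))) (ℤ.+≤+ a≤b))

∣z/1∣≡toℚ∣z∣ : ∀ z → ∣ z / 1 ∣ ≡ toℚ ℤ.∣ z ∣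
∣z/1∣≡toℚ∣z∣ (+ m)      rewrite toℚ≡mkℚ m = refl
∣z/1∣≡toℚ∣z∣ (-[1+ m ]) = trans (ℚ.∣-p∣≡∣p∣ (toℚ (suc m))) (∣z/1∣≡toℚ∣z∣ (+ suc m))

½*toℚ : ∀ m → ½ * toℚ m ≡ + m / 2
½*toℚ m rewrite toℚ≡mkℚ m = ℚ./-cong (ℤ.*-identityˡ (+ m)) refl

sum-toℚ-≤ : ∀ {n} (b : Fin n → ℕ) {T} → (∀ i → toℚ (b i) ≤ T) → toℚ (sum b) ≤ toℚ n * T
sum-toℚ-≤ {zero}  b {T} b≤T = ℚ.≤-reflexive (sym (ℚ.*-zeroˡ T))
sum-toℚ-≤ {suc n} b {T} b≤T = begin
  toℚ (b zero ℕ.+ sum (b ∘ suc))       ≡⟨ toℚ-+ (b zero) (sum (b ∘ suc)) ⟩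
  toℚ (b zero) + toℚ (sum (b ∘ suc))   ≤⟨ ℚ.+-mono-≤ (b≤T zero) (sum-toℚ-≤ (b ∘ suc) (b≤T ∘ suc)) ⟩
  T + toℚ n * T                        ≡⟨ cong (_+ toℚ n * T) (ℚ.*-identityˡ T) ⟨
  1ℚ * T + toℚ n * T                   ≡⟨ ℚ.*-distribʳ-+ T 1ℚ (toℚ n) ⟨
  (1ℚ + toℚ n) * T                     ≡⟨ cong (_* T) (toℚ-+ 1 n) ⟨
  toℚ (suc n) * T                      ∎
  where open ℚ.≤-Reasoning

halved-bound : ∀ {n} (b : Fin n → ℤ) z {T} → 0ℚ ≤ T → (∀ i → ∣ b i / 1 ∣ ≤ T) →
  2 ℕ.* ℤ.∣ z ∣ ℕ.≤ 2 ℕ.+ sum (λ i → ℤ.∣ b i ∣) → ∣ z / 1 ∣ ≤ (+ suc n / 2) * T + 1ℚ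
halved-bound {n} b z {T} 0≤T b≤T 2z≤ = begin
  ∣ z / 1 ∣                                     ≡⟨ ∣z/1∣≡toℚ∣z∣ z ⟩
  toℚ ℤ.∣ z ∣                                   ≡⟨ ℚ.*-identityˡ (toℚ ℤ.∣ z ∣) ⟨
  ½ * toℚ 2 * toℚ ℤ.∣ z ∣                       ≡⟨ ℚ.*-assoc ½ (toℚ 2) (toℚ ℤ.∣ z ∣) ⟩
  ½ * (toℚ 2 * toℚ ℤ.∣ z ∣)                     ≤⟨ ℚ.*-monoˡ-≤-nonNeg ½ doubled ⟩
  ½ * (toℚ 2 + toℚ (suc n) * T)                 ≡⟨ ℚ.*-distribˡ-+ ½ (toℚ 2) (toℚ (suc n) * T) ⟩
  1ℚ + ½ * (toℚ (suc n) * T)                    ≡⟨ cong (_+_ 1ℚ) (ℚ.*-assoc ½ (toℚ (suc n)) T) ⟨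
  1ℚ + ½ * toℚ (suc n) * T                      ≡⟨ cong (λ x → 1ℚ + x * T) (½*toℚ (suc n)) ⟩
  1ℚ + (+ suc n / 2) * T                        ≡⟨ ℚ.+-comm 1ℚ ((+ suc n / 2) * T) ⟩
  (+ suc n / 2) * T + 1ℚ                        ∎
  where
  open ℚ.≤-Reasoning
  instance
    T-nonNeg : NonNegative T
    T-nonNeg = nonNegative 0≤T
  doubled : toℚ 2 * toℚ ℤ.∣ z ∣ ≤ toℚ 2 + toℚ (suc n) * T
  doubled = begin
    toℚ 2 * toℚ ℤ.∣ z ∣                                 ≡⟨ toℚ-* 2 ℤ.∣ z ∣ ⟨
    toℚ (2 ℕ.* ℤ.∣ z ∣)                                 ≤⟨ toℚ-mono-≤ 2z≤ ⟩
    toℚ (2 ℕ.+ sum (λ i → ℤ.∣ b i ∣))                   ≡⟨ toℚ-+ 2 (sum (λ i → ℤ.∣ b i ∣)) ⟩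
    toℚ 2 + toℚ (sum (λ i → ℤ.∣ b i ∣))                 ≤⟨ ℚ.+-monoʳ-≤ (toℚ 2) (sum-toℚ-≤ (λ i → ℤ.∣ b i ∣) λ i → subst (_≤ T) (∣z/1∣≡toℚ∣z∣ (b i)) (b≤T i)) ⟩
    toℚ 2 + toℚ n * T                                   ≤⟨ ℚ.+-monoʳ-≤ (toℚ 2) (ℚ.*-monoʳ-≤-nonNeg T (toℚ-mono-≤ (ℕ.n≤1+n n))) ⟩
    toℚ 2 + toℚ (suc n) * T                             ∎

proposition4p2 : (k : ℕ) → suc k ≥ 2 → (T : ℚ) → 0ℚ < T →
    (B : Mat k (suc k)) →
    (∀ i j → ∣ B i j / 1 ∣ ≤ T) →
    (∃ λ (r : Fin (suc k) → ℤ) → InSL (appendRow B r)) →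
    ∃ λ (r : Fin (suc k) → ℤ) → InSL (appendRow B r) × (∀ j → ∣ r j / 1 ∣ ≤ (+ suc k / 2) * T + 1ℚ)
proposition4p2 k _ T 0<T B B≤T (s , det≡1) =
  let r , det-r≡1 , short = short-completion B s det≡1
  in r , det-r≡1 , λ j → halved-bound (λ i → B i j) (r j) (ℚ.<⇒≤ 0<T) (λ i → B≤T i j) (short j)
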